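{- Let $q\neq1$ be real and let $f_n(x,s,q)$ be defined by $f_0=1$, $f_1=x$ and $f_n(x,s,q)=x f_{n-1}(x,s,q)+q^{n-1}s f_{n-2}(x,s,q)$ for $n\ge 2$. Then for all $n\ge0$, $$f_{2n}(x,s,q)=\sum_{k=0}^n\begin{bmatrix} n\\ k\end{bmatrix}_q q^{kn}s^kx^{n-k}f_{n-k}(x,s,q).$$
   Context: $[n]_q=\frac{1-q^n}{1-q}$, $[n]_q!=[1]_q\cdots[n]_q$, $[0]_q!=1$, and $\begin{bmatrix} n\\ k\end{bmatrix}_q=\frac{[n]_q!}{[k]_q![n-k]_q!}$ for $0\le k\le n$, $0$ otherwise. -}

module Defs where

open import Algebra.Bundles using (CommutativeRing)
open import Data.Nat using (ℕ; zero; suc)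

module QDefs {c ℓ} (R : CommutativeRing c ℓ) where
  open CommutativeRing R using (Carrier; _+_; _*_; 0#; 1#)

  pow : Carrier → ℕ → Carrier
  pow a zero    = 1#
  pow a (suc n) = a * pow a n

  f : Carrier → Carrier → Carrier → ℕ → Carrier
  f q x s zero          = 1#
  f q x s (suc zero)    = x
  f q x s (suc (suc n)) = x * f q x s (suc n) + pow q (suc n) * s * f q x s n

  -- Gaussian binomial coefficient [n choose k]_q as a polynomial in q
  -- (q-Pascal rule); equals [n]_q! / ([k]_q! [n-k]_q!) for 0 ≤ k ≤ n
  -- whenever the latter is defined, and 0 for k > n.
  qbinom : Carrier → ℕ → ℕ → Carrier
  qbinom q zero    zero    = 1#
  qbinom q zero    (suc k) = 0#
  qbinom q (suc n) zero    = 1#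
  qbinom q (suc n) (suc k) = qbinom q n k + pow q (suc k) * qbinom q n (suc k)

  sumTo : ℕ → (ℕ → Carrier) → Carrier
  sumTo zero    g = g zero
  sumTo (suc n) g = sumTo n g + g (suc n)

{-# OPTIONS --safe #-}
module Submission where

-- More generally, f (n + m) = Σ_{k ≤ m} [m k]_q q^{kn} s^k x^{m-k} f (n - k) whenever m ≤ n; the
-- theorem is the case m = n.  This goes by induction on m, trading one unit of m for one of n:
-- expanding every f (n + 1 - k) by the defining recurrence splits the sum in two, and the two
-- halves recombine by the q-Pascal rule [m+1, k+1] = [m, k] + q^{k+1} [m, k+1].

open import Defs
open import Algebra.Bundles using (CommutativeRing)
open import Data.Nat using (ℕ; _∸_) renaming (_*_ to _*ℕ_)
open import Relation.Nullary using (¬_)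

module QFibonacci {c ℓ} (R : CommutativeRing c ℓ) where
  open CommutativeRing R
  open QDefs R
  open import Data.Nat as ℕ using (zero; suc; _≤_; _<_; z≤n; s≤s)
  open import Data.Nat.Properties as ℕ using ()
  open import Function using (_∘_)
  open import Relation.Binary.PropositionalEquality as ≡ using (_≡_; cong)
  open import Relation.Binary.Reasoning.Setoid setoid
  open import Algebra.Properties.CommutativeSemigroup +-commutativeSemigroup
    using (interchange; x∙yz≈y∙xz)
  open import Algebra.Solver.Ring.NaturalCoefficients.Default commutativeSemiring
    using (solve; _:=_; _:+_; _:*_)

  pow-+ : ∀ a m n → pow a (m ℕ.+ n) ≈ pow a m * pow a n
  pow-+ a zero    n = sym (*-identityˡ _)
  pow-+ a (suc m) n = trans (*-congˡ (pow-+ a m n)) (sym (*-assoc _ _ _))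

  sumTo-cong : ∀ m {g h : ℕ → Carrier} → (∀ {k} → k ≤ m → g k ≈ h k) → sumTo m g ≈ sumTo m h
  sumTo-cong zero    g≈h = g≈h z≤n
  sumTo-cong (suc m) g≈h = +-cong (sumTo-cong m (g≈h ∘ ℕ.m≤n⇒m≤1+n)) (g≈h ℕ.≤-refl)

  sumTo-+ : ∀ m (g h : ℕ → Carrier) → sumTo m (λ k → g k + h k) ≈ sumTo m g + sumTo m h
  sumTo-+ zero    g h = refl
  sumTo-+ (suc m) g h = trans (+-congʳ (sumTo-+ m g h)) (interchange _ _ _ _)

  sumTo-shift : ∀ m (g : ℕ → Carrier) → sumTo (suc m) g ≈ g 0 + sumTo m (g ∘ suc)
  sumTo-shift zero    g = refl
  sumTo-shift (suc m) g = trans (+-congʳ (sumTo-shift m g)) (+-assoc _ _ _)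

  module _ (q : Carrier) where

    qbinom-zeroʳ : ∀ m → qbinom q m 0 ≈ 1#
    qbinom-zeroʳ zero    = refl
    qbinom-zeroʳ (suc m) = refl

    m<k⇒qbinom≈0 : ∀ {m k} → m < k → qbinom q m k ≈ 0#
    m<k⇒qbinom≈0 {zero}  {suc k} _         = refl
    m<k⇒qbinom≈0 {suc m} {suc k} (s≤s m<k) = begin
      qbinom q m k + pow q (suc k) * qbinom q m (suc k)
        ≈⟨ +-cong (m<k⇒qbinom≈0 m<k) (*-congˡ (m<k⇒qbinom≈0 (ℕ.m<n⇒m<1+n m<k))) ⟩
      0# + pow q (suc k) * 0#  ≈⟨ trans (+-identityˡ _) (zeroʳ _) ⟩
      0#                       ∎

    qbinom-pascal-sum : ∀ m (g : ℕ → Carrier) →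
      sumTo (suc m) (λ k → qbinom q (suc m) k * g k) ≈
      sumTo m (λ k → qbinom q m k * (g (suc k) + pow q k * g k))
    qbinom-pascal-sum m g = begin
      sumTo (suc m) (λ k → qbinom q (suc m) k * g k)
        ≈⟨ sumTo-shift m _ ⟩
      1# * g 0 + sumTo m (λ k → (b k + pow q (suc k) * b (suc k)) * g (suc k))
        ≈⟨ +-cong (*-identityˡ _) (sumTo-cong m (λ _ → pascal-split _)) ⟩
      g 0 + sumTo m (λ k → b k * g (suc k) + h (suc k))
        ≈⟨ +-congˡ (sumTo-+ m _ _) ⟩
      g 0 + (sumTo m (λ k → b k * g (suc k)) + sumTo m (h ∘ suc))
        ≈⟨ x∙yz≈y∙xz _ _ _ ⟩
      sumTo m (λ k → b k * g (suc k)) + (g 0 + sumTo m (h ∘ suc))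
        ≈⟨ +-congˡ (sym h-sum) ⟩
      sumTo m (λ k → b k * g (suc k)) + sumTo m h
        ≈⟨ trans (sym (sumTo-+ m _ _)) (sumTo-cong m (λ _ → sym (distribˡ _ _ _))) ⟩
      sumTo m (λ k → b k * (g (suc k) + pow q k * g k)) ∎
      where
        b : ℕ → Carrier
        b = qbinom q m
        h : ℕ → Carrier
        h k = b k * (pow q k * g k)
        pascal-split : ∀ k → (b k + pow q (suc k) * b (suc k)) * g (suc k) ≈ b k * g (suc k) + h (suc k)
        pascal-split k = solve 4 (λ b₀ p b₁ g₁ → (b₀ :+ p :* b₁) :* g₁ := b₀ :* g₁ :+ b₁ :* (p :* g₁))
                               refl (b k) (pow q (suc k)) (b (suc k)) (g (suc k))
        h-sum : sumTo m h ≈ g 0 + sumTo m (h ∘ suc)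
        h-sum = begin
          sumTo m h                 ≈⟨ sym (+-identityʳ _) ⟩
          sumTo m h + 0#            ≈⟨ +-congˡ (sym (trans (*-congʳ (m<k⇒qbinom≈0 (ℕ.n<1+n m))) (zeroˡ _))) ⟩
          sumTo (suc m) h           ≈⟨ sumTo-shift m h ⟩
          h 0 + sumTo m (h ∘ suc)   ≈⟨ +-congʳ (trans (*-congʳ (qbinom-zeroʳ m)) (trans (*-identityˡ _) (*-identityˡ _))) ⟩
          g 0 + sumTo m (h ∘ suc)   ∎

  module _ (q x s : Carrier) where

    weight : ℕ → ℕ → ℕ → Carrier
    weight m n k = pow q (k ℕ.* n) * pow s k * pow x (m ∸ k) * f q x s (n ∸ k)

    qbinom*weight : ∀ m n k →
      qbinom q m k * pow q (k ℕ.* n) * pow s k * pow x (m ∸ k) * f q x s (n ∸ k) ≈ qbinom q m k * weight m n k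
    qbinom*weight m n k = trans (*-congʳ (trans (*-congʳ (*-assoc _ _ _)) (*-assoc _ _ _))) (*-assoc _ _ _)

    weight-recurrence : ∀ {m n k} → k ≤ m → k ≤ n →
      weight m (suc (suc n)) k ≈ weight (suc m) (suc n) (suc k) + pow q k * weight (suc m) (suc n) k
    weight-recurrence {m} {n} {k} k≤m k≤n = begin
      weight m (suc (suc n)) k
        ≈⟨ *-cong (*-congʳ (*-congʳ q-outer)) (reflexive (cong (f q x s) (ℕ.+-∸-assoc 2 k≤n))) ⟩
      qᵏ * Q * S * X * (x * F₁ + qʲ⁺¹ * s * F₀)
        ≈⟨ solve 9 (λ qᵏ qʲ⁺¹ Q S X x s F₀ F₁ →
                      qᵏ :* Q :* S :* X :* (x :* F₁ :+ qʲ⁺¹ :* s :* F₀)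
                   := qᵏ :* qʲ⁺¹ :* Q :* (s :* S) :* X :* F₀ :+ qᵏ :* (Q :* S :* (x :* X) :* F₁))
                 refl qᵏ qʲ⁺¹ Q S X x s F₀ F₁ ⟩
      qᵏ * qʲ⁺¹ * Q * (s * S) * X * F₀ + qᵏ * (Q * S * (x * X) * F₁)
        ≈⟨ sym (+-cong (*-congʳ (*-congʳ (*-congʳ q-inner)))
                        (*-congˡ (*-cong (*-congˡ (reflexive (cong (pow x) (ℕ.+-∸-assoc 1 k≤m))))
                                         (reflexive (cong (f q x s) (ℕ.+-∸-assoc 1 k≤n)))))) ⟩
      weight (suc m) (suc n) (suc k) + pow q k * weight (suc m) (suc n) k ∎
      where
        j : ℕ
        j = n ∸ k
        qᵏ qʲ⁺¹ Q S X F₀ F₁ : Carrier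
        qᵏ   = pow q k
        qʲ⁺¹ = pow q (suc j)
        Q    = pow q (k ℕ.* suc n)
        S    = pow s k
        X    = pow x (m ∸ k)
        F₀   = f q x s j
        F₁   = f q x s (suc j)
        q-outer : pow q (k ℕ.* suc (suc n)) ≈ qᵏ * Q
        q-outer = trans (reflexive (cong (pow q) (ℕ.*-suc k (suc n)))) (pow-+ q k _)
        n-split : k ℕ.+ suc j ≡ suc n
        n-split = ≡.trans (ℕ.+-suc k j) (cong suc (ℕ.m+[n∸m]≡n k≤n))
        q-inner : pow q (suc k ℕ.* suc n) ≈ qᵏ * qʲ⁺¹ * Q
        q-inner = trans (pow-+ q (suc n) (k ℕ.* suc n))
                        (*-congʳ (trans (reflexive (cong (pow q) (≡.sym n-split))) (pow-+ q k (suc j))))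

    f-+ : ∀ {m n} → m ≤ n → f q x s (n ℕ.+ m) ≈ sumTo m (λ k → qbinom q m k * weight m n k)
    f-+ {zero} {n} _ = begin
      f q x s (n ℕ.+ 0)                ≡⟨ cong (f q x s) (ℕ.+-identityʳ n) ⟩
      f q x s n                        ≈⟨ sym (*-identityˡ _) ⟩
      1# * f q x s n                   ≈⟨ *-congʳ (sym (trans (*-identityʳ _) (*-identityˡ _))) ⟩
      1# * 1# * 1# * f q x s n         ≈⟨ sym (*-identityˡ _) ⟩
      1# * (1# * 1# * 1# * f q x s n)  ∎
    f-+ {suc m} {suc n} (s≤s m≤n) = begin
      f q x s (suc n ℕ.+ suc m)
        ≡⟨ cong (f q x s ∘ suc) (ℕ.+-suc n m) ⟩
      f q x s (suc (suc n) ℕ.+ m)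
        ≈⟨ f-+ (ℕ.m≤n⇒m≤1+n (ℕ.m≤n⇒m≤1+n m≤n)) ⟩
      sumTo m (λ k → qbinom q m k * weight m (suc (suc n)) k)
        ≈⟨ sumTo-cong m (λ k≤m → *-congˡ (weight-recurrence k≤m (ℕ.≤-trans k≤m m≤n))) ⟩
      sumTo m (λ k → qbinom q m k * (weight (suc m) (suc n) (suc k) + pow q k * weight (suc m) (suc n) k))
        ≈⟨ sym (qbinom-pascal-sum q m _) ⟩
      sumTo (suc m) (λ k → qbinom q (suc m) k * weight (suc m) (suc n) k) ∎

open CommutativeRing using (Carrier; _≈_; _*_; 1#)
open QDefs using (f; qbinom; pow; sumTo)

mainTheorem5 : ∀ {c ℓ} (R : CommutativeRing c ℓ) →
    (q x s : Carrier R) → ¬ (_≈_ R q (1# R)) → (n : ℕ) →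
      _≈_ R (f R q x s (2 *ℕ n))
        (sumTo R n (λ k → _*_ R (_*_ R (_*_ R (_*_ R (qbinom R q n k) (pow R q (k *ℕ n))) (pow R s k)) (pow R x (n ∸ k))) (f R q x s (n ∸ k))))
mainTheorem5 R q x s _ n =
  trans (reflexive (cong (f R q x s) (cong (n +_) (+-identityʳ n))))
        (trans (f-+ q x s (≤-refl {n})) (sumTo-cong n (λ {k} _ → sym (qbinom*weight q x s n n k))))
  where
    open CommutativeRing R using (trans; reflexive; sym)
    open QFibonacci R using (f-+; sumTo-cong; qbinom*weight)
    open import Data.Nat using (_+_)
    open import Data.Nat.Properties using (+-identityʳ; ≤-refl)
    open import Relation.Binary.PropositionalEquality using (cong)
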